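{- For every partition $\lambda$ and positive integer $k$, there is a bijection between $\mathrm{BSSYT}(\lambda,k)$ and the set of triples $(Q,j,C')$ with $Q\in\mathrm{RPP}(\lambda,k)$, $1\le j\le k$, and $C'$ a proper outside corner of the induced subshape $\alpha(Q,j)$. That is, each barely set-valued tableau in $\mathrm{BSSYT}(\lambda,k)$ is uniquely represented by such a triple.
   Context: A partition $\lambda$ is identified with its Young diagram (square $(s,t)$ in row $s$, column $t$, rows numbered from the top). A set-valued semistandard Young tableau of shape $\lambda$ assigns a nonempty finite set of positive integers to each square such that for horizontally adjacent sets $A$ (left), $B$ (right), $\max A\le\min B$, and for vertically adjacent $A$ (above), $B$ (below), $\max A<\min B$; it is barely set-valued if exactly one square has a set of size two and all others have size one. $\mathrm{BSSYT}(\lambda,k)$ is the set of barely set-valued semistandard Young tableaux of shape $\lambda$ with every integer in row $s$ at most $k+s$. $\mathrm{RPP}(\lambda,k)$ is the set of reverse plane partitions of shape $\lambda$ with entries in $\{0,1,\dots,k\}$ (weakly increasing along rows and down columns). For $Q\in\mathrm{RPP}(\lambda,k)$ and $1\le j\le k$, $\alpha(Q,j)$ is the subshape consisting of the squares of $Q$ with entries strictly less than $j$. A proper outside corner of a subshape $\mu\subseteq\lambda$ is a square $(s,t)\in\lambda\setminus\mu$ such that ($s=1$ or $(s-1,t)\in\mu$) and ($t=1$ or $(s,t-1)\in\mu$). -}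

module Defs where

open import Data.Nat using (ℕ; zero; suc; _+_; _∸_; _≤_; _<_)
open import Data.List using (List; []; _∷_; map; length)
open import Data.List.Relation.Unary.All using (All)
open import Data.List.Relation.Unary.Linked using (Linked)
open import Data.List.Membership.Propositional using (_∈_)
open import Data.Product using (_×_; Σ; ∃)
open import Data.Sum using (_⊎_)
open import Relation.Binary.PropositionalEquality using (_≡_; _≢_)
open import Relation.Nullary using (¬_)

lookupD : {A : Set} → A → List A → ℕ → A
lookupD d []       _       = d
lookupD d (x ∷ xs) zero    = x
lookupD d (x ∷ xs) (suc n) = lookupD d xs n

IsPartition : List ℕ → Set
IsPartition la = All (λ x → 1 ≤ x) la × Linked (λ a b → b ≤ a) la

-- length of row s (rows numbered from 1); 0 outside the partition
rowLen : List ℕ → ℕ → ℕ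
rowLen la s = lookupD 0 la (s ∸ 1)

-- (s , t) is a square of the Young diagram of la (1-indexed, English)
InShape : List ℕ → ℕ → ℕ → Set
InShape la s t = (1 ≤ s) × (1 ≤ t) × (t ≤ rowLen la s)

HasShape : {A : Set} → List (List A) → List ℕ → Set
HasShape T la = map length T ≡ la

-- entry in square (s , t) (1-indexed); default outside
at : {A : Set} → A → List (List A) → ℕ → ℕ → A
at d T s t = lookupD d (lookupD [] T (s ∸ 1)) (t ∸ 1)

-- Set-valued tableaux.
-- A nonempty finite set of positive integers is represented canonically
-- by its strictly increasing list of elements.

IsPosFinSet : List ℕ → Set
IsPosFinSet A = (A ≢ []) × Linked _<_ A × All (λ x → 1 ≤ x) A

entryS : List (List (List ℕ)) → ℕ → ℕ → List ℕ
entryS = at []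

WeakBelow : List ℕ → List ℕ → Set
WeakBelow A B = ∀ a b → a ∈ A → b ∈ B → a ≤ b

StrictBelow : List ℕ → List ℕ → Set
StrictBelow A B = ∀ a b → a ∈ A → b ∈ B → a < b

IsSetValuedSSYT : List ℕ → List (List (List ℕ)) → Set
IsSetValuedSSYT la T =
    HasShape T la
  × (∀ s t → InShape la s t → IsPosFinSet (entryS T s t))
  × (∀ s t → InShape la s t → InShape la s (suc t) →
       WeakBelow (entryS T s t) (entryS T s (suc t)))
  × (∀ s t → InShape la s t → InShape la (suc s) t →
       StrictBelow (entryS T s t) (entryS T (suc s) t))

IsBarely : List ℕ → List (List (List ℕ)) → Set
IsBarely la T =
  Σ ℕ λ s₀ → Σ ℕ λ t₀ →
      InShape la s₀ t₀
    × length (entryS T s₀ t₀) ≡ 2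
    × (∀ s t → InShape la s t → ¬ (s ≡ s₀ × t ≡ t₀) →
         length (entryS T s t) ≡ 1)

RowBounded : List ℕ → ℕ → List (List (List ℕ)) → Set
RowBounded la k T =
  ∀ s t → InShape la s t → ∀ x → x ∈ entryS T s t → x ≤ k + s

IsBSSYT : List ℕ → ℕ → List (List (List ℕ)) → Set
IsBSSYT la k T = IsSetValuedSSYT la T × IsBarely la T × RowBounded la k T

-- BSSYT(λ,k); the validity proof is irrelevant, so equality is equality
-- of the underlying fillings.
record BSSYT (la : List ℕ) (k : ℕ) : Set where
  constructor bssyt
  field
    tab    : List (List (List ℕ))
    .valid : IsBSSYT la k tab

IsRPP : List ℕ → ℕ → List (List ℕ) → Set
IsRPP la k Q =
    HasShape Q la
  × (∀ s t → InShape la s t → at 0 Q s t ≤ k)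
  × (∀ s t → InShape la s t → InShape la s (suc t) →
       at 0 Q s t ≤ at 0 Q s (suc t))
  × (∀ s t → InShape la s t → InShape la (suc s) t →
       at 0 Q s t ≤ at 0 Q (suc s) t)

record RPP (la : List ℕ) (k : ℕ) : Set where
  constructor rpp
  field
    filling : List (List ℕ)
    .valid  : IsRPP la k filling

InAlpha : List ℕ → List (List ℕ) → ℕ → ℕ → ℕ → Set
InAlpha la Q j s t = InShape la s t × at 0 Q s t < j

IsProperOutsideCorner : List ℕ → List (List ℕ) → ℕ → ℕ → ℕ → Set
IsProperOutsideCorner la Q j s t =
    InShape la s t
  × ¬ InAlpha la Q j s t
  × (s ≡ 1 ⊎ InAlpha la Q j (s ∸ 1) t)
  × (t ≡ 1 ⊎ InAlpha la Q j s (t ∸ 1))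

record Triple (la : List ℕ) (k : ℕ) : Set where
  constructor triple
  field
    Q        : RPP la k
    j        : ℕ
    .j-pos   : 1 ≤ j
    .j≤k     : j ≤ k
    cs       : ℕ
    ct       : ℕ
    .corner  : IsProperOutsideCorner la (RPP.filling Q) j cs ct

-- Subtracting the row index s from the largest element of every square of a barely set-valued
-- tableau T gives a reverse plane partition Q with entries in {0,…,k}: column strictness makes
-- these shifted maxima weakly increase down columns, and the row bound k + s caps them at k.
-- If {a, b} is the unique doubled square, at (s,t), put j = a − (s − 1). Column strictness and
-- weak row increase at (s,t) say precisely that the squares above and to the left of (s,t) lie
-- in α(Q,j), while a < b keeps (s,t) itself out of it; so (s,t) is a proper outside corner.
-- Conversely a triple (Q, j, (s,t)) is filled back in by putting {Q(s′,t′) + s′} in every square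
-- and adding j + s − 1 at the corner, which inverts the construction.

module Submission where

open import Defs
open import Data.List using (List; []; _∷_; map; length)
import Data.List.Properties as List
open import Data.List.Membership.Propositional using (_∈_)
open import Data.List.Relation.Unary.All as All using ([]; _∷_)
open import Data.List.Relation.Unary.Any using (here; there)
open import Data.List.Relation.Unary.Linked using (Linked; [-]; _∷_)
open import Data.Maybe using (Maybe; just; nothing; fromMaybe; _<∣>_)
import Data.Maybe as Maybe
open import Data.Nat using (ℕ; zero; suc; pred; _+_; _∸_; _≤_; _<_; z≤n; s≤s; _≟_)
open import Data.Nat.Properties
open import Data.Product using (_×_; _,_; proj₁; proj₂; map₁)
open import Data.Sum using (_⊎_; inj₁; inj₂)
open import Function using (_∘_)
open import Function.Bundles using (_⤖_; mk↔ₛ′)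
open import Function.Properties.Inverse using (↔⇒⤖)
open import Relation.Binary.PropositionalEquality
open import Relation.Nullary using (¬_; Dec; yes; no; contradiction)
open import Relation.Nullary.Decidable using (_×-dec_; recompute)
open import Relation.Unary using (Decidable)

private
  variable
    A B : Set

lookupD-map : (f : A → B) (d : A) (xs : List A) (i : ℕ) →
  lookupD (f d) (map f xs) i ≡ f (lookupD d xs i)
lookupD-map f d []       i       = refl
lookupD-map f d (x ∷ xs) zero    = refl
lookupD-map f d (x ∷ xs) (suc i) = lookupD-map f d xs i

mapWithIndex : (ℕ → A → B) → List A → List B
mapWithIndex f []       = []
mapWithIndex f (x ∷ xs) = f 0 x ∷ mapWithIndex (f ∘ suc) xs

length-mapWithIndex : (f : ℕ → A → B) (xs : List A) → length (mapWithIndex f xs) ≡ length xs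
length-mapWithIndex f []       = refl
length-mapWithIndex f (x ∷ xs) = cong suc (length-mapWithIndex (f ∘ suc) xs)

lookupD-mapWithIndex : (f : ℕ → A → B) {d : B} {d′ : A} (xs : List A) {i : ℕ} →
  i < length xs → lookupD d (mapWithIndex f xs) i ≡ f i (lookupD d′ xs i)
lookupD-mapWithIndex f (x ∷ xs) {zero}  _         = refl
lookupD-mapWithIndex f (x ∷ xs) {suc i} (s≤s i<n) = lookupD-mapWithIndex (f ∘ suc) xs i<n

lookupD-ext : (d : A) {xs ys : List A} → length xs ≡ length ys →
  (∀ i → i < length xs → lookupD d xs i ≡ lookupD d ys i) → xs ≡ ys
lookupD-ext d {[]}     {[]}     _  _  = refl
lookupD-ext d {x ∷ xs} {y ∷ ys} eq pt =
  cong₂ _∷_ (pt 0 (s≤s z≤n)) (lookupD-ext d (suc-injective eq) (λ i → pt (suc i) ∘ s≤s))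

mapWithPos : (ℕ → ℕ → A → B) → List (List A) → List (List B)
mapWithPos f = mapWithIndex (λ i → mapWithIndex (λ c → f (suc i) (suc c)))

shape-mapWithPos : (f : ℕ → ℕ → A → B) {la : List ℕ} {X : List (List A)} →
  HasShape X la → HasShape (mapWithPos f X) la
shape-mapWithPos f {X = X} refl = go f X
  where
  go : (f : ℕ → ℕ → A → B) (X : List (List A)) → map length (mapWithPos f X) ≡ map length X
  go f []      = refl
  go f (r ∷ X) = cong₂ _∷_ (length-mapWithIndex _ r) (go (f ∘ suc) X)

rowLen-map-length : (X : List (List A)) (i : ℕ) →
  rowLen (map length X) (suc i) ≡ length (lookupD [] X i)
rowLen-map-length X i = lookupD-map length [] X i

InShape-bounds : (X : List (List A)) {i c : ℕ} → InShape (map length X) (suc i) (suc c) →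
  i < length X × c < length (lookupD [] X i)
InShape-bounds X {i} {c} (_ , _ , c<) = row< X i (≤-trans (s≤s z≤n) c<′) , c<′
  where
  c<′ : c < length (lookupD [] X i)
  c<′ = subst (_ ≤_) (rowLen-map-length X i) c<
  row< : (X : List (List A)) (i : ℕ) → 0 < length (lookupD [] X i) → i < length X
  row< (r ∷ X) zero    _ = s≤s z≤n
  row< (r ∷ X) (suc i) p = s≤s (row< X i p)

at-mapWithPos : (f : ℕ → ℕ → A → B) {d : A} {d′ : B} {la : List ℕ} {X : List (List A)} →
  HasShape X la → ∀ {s t} → InShape la s t → at d′ (mapWithPos f X) s t ≡ f s t (at d X s t)
at-mapWithPos f {d} {d′} {X = X} refl {suc i} {suc c} ins = begin
  lookupD d′ (lookupD [] (mapWithPos f X) i) c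
    ≡⟨ cong (λ r → lookupD d′ r c) (lookupD-mapWithIndex _ X i<) ⟩
  lookupD d′ (mapWithIndex (λ c → f (suc i) (suc c)) (lookupD [] X i)) c
    ≡⟨ lookupD-mapWithIndex _ (lookupD [] X i) c< ⟩
  f (suc i) (suc c) (lookupD d (lookupD [] X i) c) ∎
  where
  open ≡-Reasoning
  i< : i < length X
  i< = proj₁ (InShape-bounds X ins)
  c< : c < length (lookupD [] X i)
  c< = proj₂ (InShape-bounds X ins)

rows-ext : (d : A) (X Y : List (List A)) → map length X ≡ map length Y →
  (∀ i c → c < length (lookupD [] X i) →
    lookupD d (lookupD [] X i) c ≡ lookupD d (lookupD [] Y i) c) →
  X ≡ Y
rows-ext d []      []      _  _  = refl
rows-ext d (r ∷ X) (q ∷ Y) eq pt =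
  cong₂ _∷_ (lookupD-ext d (proj₁ (List.∷-injective eq)) (pt 0))
            (rows-ext d X Y (proj₂ (List.∷-injective eq)) (λ i → pt (suc i)))

filling-ext : (d : A) {la : List ℕ} {X Y : List (List A)} → HasShape X la → HasShape Y la →
  (∀ s t → InShape la s t → at d X s t ≡ at d Y s t) → X ≡ Y
filling-ext d {X = X} {Y} refl Y-shape pt =
  rows-ext d X Y (sym Y-shape) (λ i c → pt (suc i) (suc c) ∘ inShape i c)
  where
  inShape : ∀ i c → c < length (lookupD [] X i) → InShape (map length X) (suc i) (suc c)
  inShape i c c< = s≤s z≤n , s≤s z≤n , subst (_ ≤_) (sym (rowLen-map-length X i)) c<

firstIndex : {P : A → Set} → Decidable P → List A → Maybe ℕ
firstIndex P? []       = nothing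
firstIndex P? (x ∷ xs) with P? x
... | yes _ = just 0
... | no  _ = Maybe.map suc (firstIndex P? xs)

firstIndex-unique : {P : A → Set} (P? : Decidable P) {d : A} (xs : List A) {i : ℕ} →
  i < length xs → P (lookupD d xs i) →
  (∀ i′ → i′ < length xs → P (lookupD d xs i′) → i′ ≡ i) → firstIndex P? xs ≡ just i
firstIndex-unique P? (x ∷ xs) {zero} _ p _ with P? x
... | yes _  = refl
... | no ¬p = contradiction p ¬p
firstIndex-unique P? (x ∷ xs) {suc i} (s≤s i<) p uniq with P? x
... | yes px = contradiction (uniq 0 (s≤s z≤n) px) 0≢1+n
... | no  _  = cong (Maybe.map suc)
  (firstIndex-unique P? xs i< p (λ i′ i′< p′ → suc-injective (uniq (suc i′) (s≤s i′<) p′)))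

firstIndex-none : {P : A → Set} (P? : Decidable P) {d : A} (xs : List A) →
  (∀ i → i < length xs → ¬ P (lookupD d xs i)) → firstIndex P? xs ≡ nothing
firstIndex-none P? []       _    = refl
firstIndex-none P? (x ∷ xs) none with P? x
... | yes px = contradiction px (none 0 (s≤s z≤n))
... | no  _  = cong (Maybe.map suc) (firstIndex-none P? xs (λ i → none (suc i) ∘ s≤s))

firstPos : {P : A → Set} → Decidable P → List (List A) → Maybe (ℕ × ℕ)
firstPos P? []       = nothing
firstPos P? (r ∷ rs) =
  Maybe.map (λ c → 1 , suc c) (firstIndex P? r) <∣> Maybe.map (map₁ suc) (firstPos P? rs)

firstPos-unique : {P : A → Set} (P? : Decidable P) {d : A} {la : List ℕ} {X : List (List A)} →
  HasShape X la → ∀ {s t} → InShape la s t → P (at d X s t) →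
  (∀ s′ t′ → InShape la s′ t′ → P (at d X s′ t′) → s′ ≡ s × t′ ≡ t) →
  firstPos P? X ≡ just (s , t)
firstPos-unique P? {X = []} refl (_ , s≤s _ , ())
firstPos-unique P? {X = r ∷ rs} refl {suc zero} {suc c} (_ , _ , c<) p uniq
  rewrite firstIndex-unique P? r c< p
            (λ c′ c′< p′ →
              suc-injective (proj₂ (uniq 1 (suc c′) (s≤s z≤n , s≤s z≤n , c′<) p′)))
  = refl
firstPos-unique {P = P} P? {d = d} {X = r ∷ rs} refl {suc (suc i)} {t} (_ , 1≤t , t≤) p uniq
  rewrite firstIndex-none P? r
            (λ c c< p′ →
              0≢1+n (suc-injective (proj₁ (uniq 1 (suc c) (s≤s z≤n , s≤s z≤n , c<) p′))))
  = cong (Maybe.map (map₁ suc)) (firstPos-unique P? {X = rs} refl (s≤s z≤n , 1≤t , t≤) p uniq′)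
  where
  uniq′ : ∀ s′ t′ → InShape (map length rs) s′ t′ → P (at d rs s′ t′) → s′ ≡ suc i × t′ ≡ t
  uniq′ (suc i′) t′ (_ , ins) p′ =
    map₁ suc-injective (uniq (suc (suc i′)) t′ (s≤s z≤n , ins) p′)

rowLen-suc≤ : {la : List ℕ} → Linked (λ a b → b ≤ a) la → ∀ s →
  rowLen la (suc (suc s)) ≤ rowLen la (suc s)
rowLen-suc≤ {[]}         _         s       = z≤n
rowLen-suc≤ {x ∷ []}     _         s       = z≤n
rowLen-suc≤ {x ∷ y ∷ la} (y≤x ∷ _) zero    = y≤x
rowLen-suc≤ {x ∷ y ∷ la} (_ ∷ dec) (suc s) = rowLen-suc≤ dec s

InShape-above : {la : List ℕ} → IsPartition la → ∀ {s t} →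
  InShape la (suc (suc s)) t → InShape la (suc s) t
InShape-above (_ , dec) {s} (_ , 1≤t , t≤) = s≤s z≤n , 1≤t , ≤-trans t≤ (rowLen-suc≤ dec s)

InShape-left : {la : List ℕ} → ∀ {s t} → InShape la s (suc (suc t)) → InShape la s (suc t)
InShape-left (1≤s , _ , t≤) = 1≤s , s≤s z≤n , ≤-trans (n≤1+n _) t≤

-- On the strictly increasing lists that represent entries, these are the minimum and maximum.
headD : List ℕ → ℕ
headD []      = 0
headD (x ∷ _) = x

lastD : List ℕ → ℕ
lastD []           = 0
lastD (x ∷ [])     = x
lastD (x ∷ y ∷ xs) = lastD (y ∷ xs)

last∈ : {e : List ℕ} → e ≢ [] → lastD e ∈ e
last∈ {[]}         e≢[] = contradiction refl e≢[]
last∈ {x ∷ []}     _    = here refl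
last∈ {x ∷ y ∷ xs} _    = there (last∈ (λ ()))

singleton-view : {e : List ℕ} → length e ≡ 1 → e ≡ lastD e ∷ []
singleton-view {x ∷ []} _ = refl

doubleton-view : {e : List ℕ} → length e ≡ 2 → e ≡ headD e ∷ lastD e ∷ []
doubleton-view {x ∷ y ∷ []} _ = refl

doubledIf : {P : Set} → Dec P → ℕ → ℕ → List ℕ
doubledIf (yes _) a b = a ∷ b ∷ []
doubledIf (no  _) a b = b ∷ []

module _ {P : Set} {a b : ℕ} where

  doubledIf-yes : (P? : Dec P) → P → doubledIf P? a b ≡ a ∷ b ∷ []
  doubledIf-yes (yes _) _ = refl
  doubledIf-yes (no ¬p) p = contradiction p ¬p

  doubledIf-no : (P? : Dec P) → ¬ P → doubledIf P? a b ≡ b ∷ []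
  doubledIf-no (yes p) ¬p = contradiction p ¬p
  doubledIf-no (no  _) _  = refl

  lastD-doubledIf : (P? : Dec P) → lastD (doubledIf P? a b) ≡ b
  lastD-doubledIf (yes _) = refl
  lastD-doubledIf (no  _) = refl

  ∈-doubledIf : (P? : Dec P) {x : ℕ} → x ∈ doubledIf P? a b → x ≡ b ⊎ (P × x ≡ a)
  ∈-doubledIf (yes p) (here x≡a)         = inj₂ (p , x≡a)
  ∈-doubledIf (yes _) (there (here x≡b)) = inj₁ x≡b
  ∈-doubledIf (no  _) (here x≡b)         = inj₁ x≡b

  doubledIf-length≡2 : (P? : Dec P) → length (doubledIf P? a b) ≡ 2 → P
  doubledIf-length≡2 (yes p) _ = p

  doubledIf-isPosFinSet : (P? : Dec P) → (P → 1 ≤ a × a < b) → 1 ≤ b →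
    IsPosFinSet (doubledIf P? a b)
  doubledIf-isPosFinSet (yes p) low 1≤b =
    (λ ()) , (proj₂ (low p) ∷ [-]) , (proj₁ (low p) ∷ 1≤b ∷ [])
  doubledIf-isPosFinSet (no  _) _   1≤b = (λ ()) , [-] , (1≤b ∷ [])

heightEntry : ℕ → ℕ → List ℕ → ℕ
heightEntry s _ e = lastD e ∸ s

heights : List (List (List ℕ)) → List (List ℕ)
heights = mapWithPos heightEntry

doubledSquare : List (List (List ℕ)) → ℕ × ℕ
doubledSquare T = fromMaybe (0 , 0) (firstPos (λ e → length e ≟ 2) T)

thresholdAt : List (List (List ℕ)) → ℕ × ℕ → ℕ
thresholdAt T (s , t) = headD (entryS T s t) ∸ pred s

threshold : List (List (List ℕ)) → ℕ
threshold T = thresholdAt T (doubledSquare T)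

samePos? : ∀ s t cs ct → Dec (s ≡ cs × t ≡ ct)
samePos? s t cs ct = (s ≟ cs) ×-dec (t ≟ ct)

tableauEntry : ℕ → ℕ → ℕ → ℕ → ℕ → ℕ → List ℕ
tableauEntry j cs ct s t q = doubledIf (samePos? s t cs ct) (j + pred s) (q + s)

toTableau : List (List ℕ) → ℕ → ℕ → ℕ → List (List (List ℕ))
toTableau Q j cs ct = mapWithPos (tableauEntry j cs ct) Q

module _ {la : List ℕ} where

  heights-shape : {T : List (List (List ℕ))} → HasShape T la → HasShape (heights T) la
  heights-shape = shape-mapWithPos heightEntry

  at-heights : {T : List (List (List ℕ))} → HasShape T la → ∀ {s t} → InShape la s t →
    at 0 (heights T) s t ≡ lastD (entryS T s t) ∸ s
  at-heights = at-mapWithPos heightEntry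

  toTableau-shape : {Q : List (List ℕ)} {j cs ct : ℕ} → HasShape Q la →
    HasShape (toTableau Q j cs ct) la
  toTableau-shape {j = j} {cs} {ct} = shape-mapWithPos (tableauEntry j cs ct)

  at-toTableau : {Q : List (List ℕ)} {j cs ct : ℕ} → HasShape Q la → ∀ {s t} → InShape la s t →
    entryS (toTableau Q j cs ct) s t ≡ tableauEntry j cs ct s t (at 0 Q s t)
  at-toTableau {j = j} {cs} {ct} = at-mapWithPos (tableauEntry j cs ct)

m≤n+o⇒m∸o≤n : ∀ {m} n o → m ≤ n + o → m ∸ o ≤ n
m≤n+o⇒m∸o≤n n o le = ≤-trans (∸-monoˡ-≤ o le) (≤-reflexive (m+n∸n≡m n o))

record Decoded (la : List ℕ) (k : ℕ) (T : List (List (List ℕ))) (p : ℕ × ℕ) : Set where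
  field
    heights-isRPP : IsRPP la k (heights T)
    threshold-pos : 1 ≤ thresholdAt T p
    threshold≤k   : thresholdAt T p ≤ k
    corner        : IsProperOutsideCorner la (heights T) (thresholdAt T p) (proj₁ p) (proj₂ p)
    retract       : toTableau (heights T) (thresholdAt T p) (proj₁ p) (proj₂ p) ≡ T

module Decode {la : List ℕ} (part : IsPartition la) {k : ℕ} {T : List (List (List ℕ))}
  (T-shape : HasShape T la)
  (nonempty : ∀ s t → InShape la s t → IsPosFinSet (entryS T s t))
  (rowWeak : ∀ s t → InShape la s t → InShape la s (suc t) →
    WeakBelow (entryS T s t) (entryS T s (suc t)))
  (colStrict : ∀ s t → InShape la s t → InShape la (suc s) t →
    StrictBelow (entryS T s t) (entryS T (suc s) t))
  (bounded : RowBounded la k T)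
  where

  lastD∈ : ∀ {s t} → InShape la s t → lastD (entryS T s t) ∈ entryS T s t
  lastD∈ ins = last∈ (proj₁ (nonempty _ _ ins))

  row≤entry : ∀ {s t x} → InShape la s t → x ∈ entryS T s t → s ≤ x
  row≤entry {suc zero}    {t} ins x∈ = All.lookup (proj₂ (proj₂ (nonempty 1 t ins))) x∈
  row≤entry {suc (suc s)} {t} ins x∈ =
    ≤-trans (s≤s (row≤entry above (lastD∈ above)))
            (colStrict (suc s) t above ins _ _ (lastD∈ above) x∈)
    where
    above : InShape la (suc s) t
    above = InShape-above part ins

  heights-isRPP : IsRPP la k (heights T)
  heights-isRPP = heights-shape T-shape , bound , rowMono , colMono
    where
    bound : ∀ s t → InShape la s t → at 0 (heights T) s t ≤ k
    bound s t ins rewrite at-heights T-shape ins =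
      m≤n+o⇒m∸o≤n k s (bounded s t ins _ (lastD∈ ins))
    rowMono : ∀ s t → InShape la s t → InShape la s (suc t) →
      at 0 (heights T) s t ≤ at 0 (heights T) s (suc t)
    rowMono s t ins ins′ rewrite at-heights T-shape ins | at-heights T-shape ins′ =
      ∸-monoˡ-≤ s (rowWeak s t ins ins′ _ _ (lastD∈ ins) (lastD∈ ins′))
    colMono : ∀ s t → InShape la s t → InShape la (suc s) t →
      at 0 (heights T) s t ≤ at 0 (heights T) (suc s) t
    colMono s t ins ins′ rewrite at-heights T-shape ins | at-heights T-shape ins′ =
      ∸-monoˡ-≤ (suc s) (colStrict s t ins ins′ _ _ (lastD∈ ins) (lastD∈ ins′))

  above-in-α : ∀ {i t a} → InShape la (suc i) t → a ∈ entryS T (suc i) t →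
    suc i ≡ 1 ⊎ InAlpha la (heights T) (a ∸ i) i t
  above-in-α {zero}      _   _  = inj₁ refl
  above-in-α {suc i} {t} ins a∈ = inj₂ (above , subst (_< _) (sym (at-heights T-shape above))
    (∸-monoˡ-< (colStrict (suc i) t above ins _ _ (lastD∈ above) a∈)
               (row≤entry above (lastD∈ above))))
    where
    above : InShape la (suc i) t
    above = InShape-above part ins

  left-in-α : ∀ {i c a} → InShape la (suc i) (suc c) → a ∈ entryS T (suc i) (suc c) →
    suc c ≡ 1 ⊎ InAlpha la (heights T) (a ∸ i) (suc i) c
  left-in-α {c = zero}      _   _  = inj₁ refl
  left-in-α {i} {suc c} ins a∈ = inj₂ (left , subst (_< _) (sym (at-heights T-shape left))
    (≤-<-trans (∸-monoˡ-≤ (suc i) (rowWeak (suc i) (suc c) left ins _ _ (lastD∈ left) a∈))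
               (∸-monoʳ-< (n<1+n i) (row≤entry ins a∈))))
    where
    left : InShape la (suc i) (suc c)
    left = InShape-left {la} ins

  module Doubled (i₀ c₀ : ℕ) (ins₀ : InShape la (suc i₀) (suc c₀))
    (two : length (entryS T (suc i₀) (suc c₀)) ≡ 2)
    (one : ∀ s t → InShape la s t → ¬ (s ≡ suc i₀ × t ≡ suc c₀) → length (entryS T s t) ≡ 1)
    where

    at₀? : ∀ s t → Dec (s ≡ suc i₀ × t ≡ suc c₀)
    at₀? s t = samePos? s t (suc i₀) (suc c₀)

    e₀ : List ℕ
    e₀ = entryS T (suc i₀) (suc c₀)

    a b : ℕ
    a = headD e₀
    b = lastD e₀

    e₀-view : e₀ ≡ a ∷ b ∷ []
    e₀-view = doubleton-view two

    a∈ : a ∈ e₀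
    a∈ = subst (a ∈_) (sym e₀-view) (here refl)

    b∈ : b ∈ e₀
    b∈ = subst (b ∈_) (sym e₀-view) (there (here refl))

    a<b : a < b
    a<b with subst (Linked _<_) e₀-view (proj₁ (proj₂ (nonempty _ _ ins₀)))
    ... | a<b ∷ _ = a<b

    doubledSquare-≡ : doubledSquare T ≡ (suc i₀ , suc c₀)
    doubledSquare-≡ =
      cong (fromMaybe (0 , 0)) (firstPos-unique (λ e → length e ≟ 2) T-shape ins₀ two unique)
      where
      unique : ∀ s t → InShape la s t → length (entryS T s t) ≡ 2 → s ≡ suc i₀ × t ≡ suc c₀
      unique s t ins len≡2 with at₀? s t
      ... | yes at₀ = at₀
      ... | no  ¬at₀ = contradiction (trans (sym len≡2) (one s t ins ¬at₀)) λ ()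

    not-α : ¬ InAlpha la (heights T) (a ∸ i₀) (suc i₀) (suc c₀)
    not-α (_ , lt) = <⇒≱ (subst (_< a ∸ i₀) (at-heights T-shape ins₀) lt) (∸-monoˡ-≤ (suc i₀) a<b)

    restore : ∀ {s t} → InShape la s t →
      doubledIf (at₀? s t) (a ∸ i₀ + pred s) (lastD (entryS T s t) ∸ s + s)
        ≡ entryS T s t
    restore {s} {t} ins with at₀? s t
    ... | yes (refl , refl) =
      trans (cong₂ (λ x y → x ∷ y ∷ [])
                   (m∸n+n≡m (<⇒≤ (row≤entry ins₀ a∈))) (m∸n+n≡m (row≤entry ins₀ b∈)))
            (sym e₀-view)
    ... | no ¬at₀ =
      trans (cong (_∷ []) (m∸n+n≡m (row≤entry ins (lastD∈ ins))))
            (sym (singleton-view (one s t ins ¬at₀)))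

    retract : toTableau (heights T) (a ∸ i₀) (suc i₀) (suc c₀) ≡ T
    retract = filling-ext [] (toTableau-shape (heights-shape T-shape)) T-shape λ s t ins →
      trans (at-toTableau (heights-shape T-shape) ins)
            (trans (cong (tableauEntry (a ∸ i₀) (suc i₀) (suc c₀) s t) (at-heights T-shape ins))
                   (restore ins))

    decoded : Decoded la k T (doubledSquare T)
    decoded = subst (Decoded la k T) (sym doubledSquare-≡) record
      { heights-isRPP = heights-isRPP
      ; threshold-pos = m<n⇒0<n∸m (row≤entry ins₀ a∈)
      ; threshold≤k   = m≤n+o⇒m∸o≤n k (suc i₀) (≤-trans a<b (bounded _ _ ins₀ b b∈))
      ; corner        = ins₀ , not-α , above-in-α ins₀ a∈ , left-in-α ins₀ a∈
      ; retract       = retract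
      }

decodeBSSYT : {la : List ℕ} → IsPartition la → {k : ℕ} {T : List (List (List ℕ))} →
  IsBSSYT la k T → Decoded la k T (doubledSquare T)
decodeBSSYT part (_ , (zero , _ , (() , _) , _) , _)
decodeBSSYT part (_ , (suc _ , zero , (_ , () , _) , _) , _)
decodeBSSYT part
  ((T-shape , nonempty , rowWeak , colStrict) , (suc i₀ , suc c₀ , ins₀ , two , one) , bounded) =
  Decode.Doubled.decoded part T-shape nonempty rowWeak colStrict bounded i₀ c₀ ins₀ two one

record Encoded (la : List ℕ) (k : ℕ) (Q : List (List ℕ)) (j cs ct : ℕ) : Set where
  field
    valid           : IsBSSYT la k (toTableau Q j cs ct)
    heights-≡       : heights (toTableau Q j cs ct) ≡ Q
    doubledSquare-≡ : doubledSquare (toTableau Q j cs ct) ≡ (cs , ct)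
    threshold-≡     : threshold (toTableau Q j cs ct) ≡ j

module Encode {la : List ℕ} {k : ℕ} {Q : List (List ℕ)}
  (Q-shape : HasShape Q la)
  (bounded : ∀ s t → InShape la s t → at 0 Q s t ≤ k)
  (rowMono : ∀ s t → InShape la s t → InShape la s (suc t) → at 0 Q s t ≤ at 0 Q s (suc t))
  (colMono : ∀ s t → InShape la s t → InShape la (suc s) t → at 0 Q s t ≤ at 0 Q (suc s) t)
  {j : ℕ} (j-pos : 1 ≤ j) (i₀ c₀ : ℕ)
  (corner : IsProperOutsideCorner la Q j (suc i₀) (suc c₀))
  where

  q : ℕ → ℕ → ℕ
  q = at 0 Q

  at₀? : ∀ s t → Dec (s ≡ suc i₀ × t ≡ suc c₀)
  at₀? s t = samePos? s t (suc i₀) (suc c₀)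

  G : List (List (List ℕ))
  G = toTableau Q j (suc i₀) (suc c₀)

  G-shape : HasShape G la
  G-shape = toTableau-shape Q-shape

  at-G : ∀ {s t} → InShape la s t → entryS G s t ≡ tableauEntry j (suc i₀) (suc c₀) s t (q s t)
  at-G = at-toTableau Q-shape

  ins₀ : InShape la (suc i₀) (suc c₀)
  ins₀ = proj₁ corner

  j≤q₀ : j ≤ q (suc i₀) (suc c₀)
  j≤q₀ = ≮⇒≥ (λ lt → proj₁ (proj₂ corner) (ins₀ , lt))

  above-corner : InShape la i₀ (suc c₀) → q i₀ (suc c₀) < j
  above-corner (1≤i₀ , _) with proj₁ (proj₂ (proj₂ corner))
  ... | inj₁ i₀≡0    = contradiction (subst (1 ≤_) (suc-injective i₀≡0) 1≤i₀) λ ()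
  ... | inj₂ (_ , lt) = lt

  left-of-corner : InShape la (suc i₀) c₀ → q (suc i₀) c₀ < j
  left-of-corner (_ , 1≤c₀ , _) with proj₂ (proj₂ (proj₂ corner))
  ... | inj₁ c₀≡0    = contradiction (subst (1 ≤_) (suc-injective c₀≡0) 1≤c₀) λ ()
  ... | inj₂ (_ , lt) = lt

  ∈-G : ∀ {s t x} → InShape la s t → x ∈ entryS G s t →
    x ≡ q s t + s ⊎ ((s ≡ suc i₀ × t ≡ suc c₀) × x ≡ j + pred s)
  ∈-G ins x∈ = ∈-doubledIf (at₀? _ _) (subst (_ ∈_) (at-G ins) x∈)

  ∈-G-≤ : ∀ {s t x} → InShape la s t → x ∈ entryS G s t → x ≤ q s t + s
  ∈-G-≤ ins x∈ with ∈-G ins x∈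
  ... | inj₁ x≡                   = ≤-reflexive x≡
  ... | inj₂ ((refl , refl) , refl) = +-mono-≤ j≤q₀ (n≤1+n i₀)

  nonempty : ∀ s t → InShape la s t → IsPosFinSet (entryS G s t)
  nonempty s t ins@(1≤s , _) = subst IsPosFinSet (sym (at-G ins))
    (doubledIf-isPosFinSet (at₀? s t) low (≤-trans 1≤s (m≤n+m s (q s t))))
    where
    low : s ≡ suc i₀ × t ≡ suc c₀ → 1 ≤ j + pred s × j + pred s < q s t + s
    low (refl , refl) = ≤-trans j-pos (m≤m+n j i₀) , +-mono-≤-< j≤q₀ (n<1+n i₀)

  rowWeak : ∀ s t → InShape la s t → InShape la s (suc t) →
    WeakBelow (entryS G s t) (entryS G s (suc t))
  rowWeak s t ins ins′ x y x∈ y∈ with ∈-G ins′ y∈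
  ... | inj₁ refl = ≤-trans (∈-G-≤ ins x∈) (+-monoˡ-≤ s (rowMono s t ins ins′))
  ... | inj₂ ((refl , refl) , refl) =
    ≤-trans (∈-G-≤ ins x∈) (≤-trans (≤-reflexive (+-suc _ i₀)) (+-monoˡ-< i₀ (left-of-corner ins)))

  colStrict : ∀ s t → InShape la s t → InShape la (suc s) t →
    StrictBelow (entryS G s t) (entryS G (suc s) t)
  colStrict s t ins ins′ x y x∈ y∈ with ∈-G ins′ y∈
  ... | inj₁ refl = ≤-<-trans (∈-G-≤ ins x∈) (+-mono-≤-< (colMono s t ins ins′) (n<1+n s))
  ... | inj₂ ((refl , refl) , refl) = ≤-<-trans (∈-G-≤ ins x∈) (+-monoˡ-< i₀ (above-corner ins))

  corner-doubleton : entryS G (suc i₀) (suc c₀) ≡ j + i₀ ∷ q (suc i₀) (suc c₀) + suc i₀ ∷ []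
  corner-doubleton = trans (at-G ins₀) (doubledIf-yes (at₀? (suc i₀) (suc c₀)) (refl , refl))

  barely : IsBarely la G
  barely = suc i₀ , suc c₀ , ins₀ , cong length corner-doubleton ,
    λ s t ins ¬at₀ → cong length (trans (at-G ins) (doubledIf-no (at₀? s t) ¬at₀))

  encoded : Encoded la k Q j (suc i₀) (suc c₀)
  encoded = record
    { valid           = (G-shape , nonempty , rowWeak , colStrict) , barely ,
                        λ s t ins x x∈ → ≤-trans (∈-G-≤ ins x∈) (+-monoˡ-≤ s (bounded s t ins))
    ; heights-≡       = heights-≡
    ; doubledSquare-≡ = doubledSquare-≡
    ; threshold-≡     = begin
        thresholdAt G (doubledSquare G)         ≡⟨ cong (thresholdAt G) doubledSquare-≡ ⟩
        headD (entryS G (suc i₀) (suc c₀)) ∸ i₀ ≡⟨ cong (λ e → headD e ∸ i₀) corner-doubleton ⟩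
        j + i₀ ∸ i₀                             ≡⟨ m+n∸n≡m j i₀ ⟩
        j                                       ∎
    }
    where
    open ≡-Reasoning
    heights-≡ : heights G ≡ Q
    heights-≡ = filling-ext 0 (heights-shape G-shape) Q-shape λ s t ins → begin
      at 0 (heights G) s t
        ≡⟨ at-heights G-shape ins ⟩
      lastD (entryS G s t) ∸ s
        ≡⟨ cong (λ e → lastD e ∸ s) (at-G ins) ⟩
      lastD (tableauEntry j (suc i₀) (suc c₀) s t (q s t)) ∸ s
        ≡⟨ cong (_∸ s) (lastD-doubledIf (at₀? s t)) ⟩
      q s t + s ∸ s
        ≡⟨ m+n∸n≡m (q s t) s ⟩
      q s t ∎
    doubledSquare-≡ : doubledSquare G ≡ (suc i₀ , suc c₀)
    doubledSquare-≡ = cong (fromMaybe (0 , 0))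
      (firstPos-unique (λ e → length e ≟ 2) G-shape ins₀ (cong length corner-doubleton)
        λ s t ins len≡2 →
          doubledIf-length≡2 (at₀? s t) (subst (λ e → length e ≡ 2) (at-G ins) len≡2))

encodeTriple : {la : List ℕ} {k : ℕ} {Q : List (List ℕ)} {j cs ct : ℕ} →
  IsRPP la k Q → 1 ≤ j → IsProperOutsideCorner la Q j cs ct → Encoded la k Q j cs ct
encodeTriple {cs = zero}  _ _ ((() , _) , _)
encodeTriple {cs = suc _} {ct = zero} _ _ ((_ , () , _) , _)
encodeTriple {cs = suc i₀} {ct = suc c₀} (Q-shape , bounded , rowMono , colMono) j-pos corner =
  Encode.encoded Q-shape bounded rowMono colMono j-pos i₀ c₀ corner

module _ {la : List ℕ} (part : IsPartition la) {k : ℕ} where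

  toTriple : BSSYT la k → Triple la k
  toTriple (bssyt T valid) =
    triple (rpp (heights T) (Decoded.heights-isRPP (decodeBSSYT part valid)))
           (threshold T) (Decoded.threshold-pos (decodeBSSYT part valid))
           (Decoded.threshold≤k (decodeBSSYT part valid))
           (proj₁ (doubledSquare T)) (proj₂ (doubledSquare T)) (Decoded.corner (decodeBSSYT part valid))

  fromTriple : Triple la k → BSSYT la k
  fromTriple (triple (rpp Q Q-valid) j j-pos _ cs ct corner) =
    bssyt (toTableau Q j cs ct) (Encoded.valid (encodeTriple Q-valid j-pos corner))

  triple-≡ : {Q Q′ : List (List ℕ)} .{v : IsRPP la k Q} .{v′ : IsRPP la k Q′}
    {j j′ cs cs′ ct ct′ : ℕ}
    .{p : 1 ≤ j} .{p′ : 1 ≤ j′} .{b : j ≤ k} .{b′ : j′ ≤ k}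
    .{c : IsProperOutsideCorner la Q j cs ct} .{c′ : IsProperOutsideCorner la Q′ j′ cs′ ct′} →
    Q ≡ Q′ → j ≡ j′ → cs ≡ cs′ → ct ≡ ct′ →
    triple (rpp Q v) j p b cs ct c ≡ triple (rpp Q′ v′) j′ p′ b′ cs′ ct′ c′
  triple-≡ refl refl refl refl = refl

  toTriple∘fromTriple : ∀ y → toTriple (fromTriple y) ≡ y
  toTriple∘fromTriple (triple (rpp Q Q-valid) j j-pos j≤k cs ct corner) =
    from-encoded (encodeTriple Q-valid j-pos corner)
    where
    from-encoded : .(Encoded la k Q j cs ct) →
      toTriple (fromTriple (triple (rpp Q Q-valid) j j-pos j≤k cs ct corner))
        ≡ triple (rpp Q Q-valid) j j-pos j≤k cs ct corner
    from-encoded E = triple-≡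
      (recompute (List.≡-dec (List.≡-dec _≟_) _ _) (Encoded.heights-≡ E))
      (recompute (_ ≟ _) (Encoded.threshold-≡ E))
      (recompute (_ ≟ _) (cong proj₁ (Encoded.doubledSquare-≡ E)))
      (recompute (_ ≟ _) (cong proj₂ (Encoded.doubledSquare-≡ E)))

  bssyt-≡ : {T T′ : List (List (List ℕ))} .{v : IsBSSYT la k T} .{v′ : IsBSSYT la k T′} →
    T ≡ T′ → bssyt T v ≡ bssyt T′ v′
  bssyt-≡ refl = refl

  fromTriple∘toTriple : ∀ x → fromTriple (toTriple x) ≡ x
  fromTriple∘toTriple (bssyt T valid) =
    bssyt-≡ (recompute (List.≡-dec (List.≡-dec (List.≡-dec _≟_)) _ _)
                       (Decoded.retract (decodeBSSYT part valid)))

-- The bijection also exists for k = 0, where both sides are empty.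
theorem3p3 : (la : List ℕ) → IsPartition la → (k : ℕ) → 1 ≤ k → BSSYT la k ⤖ Triple la k
theorem3p3 la part k _ =
  ↔⇒⤖ (mk↔ₛ′ (toTriple part) (fromTriple part)
              (toTriple∘fromTriple part) (fromTriple∘toTriple part))
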